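{- Let $D$ be the $q$-derivative of $G_{\tan\cup\sec}$ and let $\Omega(D^n(x_0))$ be the number of distinct words with nonzero coefficient in $D^n(x_0)$. For $n\ge3$, $$\Omega(D^n(x_0))=\begin{cases}2k^3+5k^2+2,& n=2k+1,\\ (k+2)(2k^2-2k+1),& n=2k.\end{cases}$$
   Context: Let $\mathbb{K}$ be a commutative ring with unity of characteristic zero and $q$ an indeterminate. Master variables $S=\{x,y\}$, variables $x_i,y_i$ ($i\ge0$), $\mathbb{S}$ the set of these; $\mathbb{E}=\mathbb{K}[q][F(\mathbb{S})]$ is the group algebra of the free group on $\mathbb{S}$. The rule $R$ is $R(x_j)=q^j(1+x_jx_{j+1})$, $R(y_j)=q^jx_jy_{j+1}$, extended to inverses by $R(s_i^{ -1})=-s_i^{ -1}R(s_i)s_{i+1}^{ -1}$. $\uparrow$ is the $\mathbb{K}[q]$-linear map replacing each letter $s_i^{\pm1}$ by $s_{i+1}^{\pm1}$. The order DIO rewrites a word by stably sorting its letters according to the total order $\cdots<x_2<y_2<x_1<y_1<x_0<y_0$ (a letter $s_i^{ -1}$ ranked as $s_i$), extended linearly. $G_{\tan\cup\sec}=(\{x,y\},R,\mathrm{DIO})$ and its $q$-derivative is the $\mathbb{K}[q]$-linear map $D(w_1\cdots w_n)=\sum_{j=1}^n\mathrm{DIO}\big(w_1\cdots w_{j-1}R(w_j)\uparrow(w_{j+1}\cdots w_n)\big)$ for letters $w_j$; $D^n$ its iterate. -}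

module Defs where

open import Data.Bool using (Bool; true; false; if_then_else_; _∧_; _∨_; not)
open import Data.Nat as ℕ using (ℕ; zero; suc; _<ᵇ_; _≡ᵇ_)
open import Data.Integer as ℤ using (ℤ)
open import Data.List using (List; []; _∷_; _++_; map; concatMap; length; filter; foldr; replicate)
open import Data.Bool.ListAction using (all; any)
open import Data.Product using (_×_; _,_; proj₁; proj₂)
open import Relation.Nullary.Decidable using (⌊_⌋; ¬?)

-- Coefficient ring ℤ[q] : polynomials as coefficient lists
-- (constant term first).  Non-normalised; zero-ness is tested by
-- checking that every coefficient is 0.

Poly : Set
Poly = List ℤ

_⊕_ : Poly → Poly → Poly
[]       ⊕ g        = g
(a ∷ f)  ⊕ []       = a ∷ f
(a ∷ f)  ⊕ (b ∷ g)  = (a ℤ.+ b) ∷ (f ⊕ g)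

scale : ℤ → Poly → Poly
scale c = map (c ℤ.*_)

_⊗_ : Poly → Poly → Poly
[]      ⊗ g = []
(a ∷ f) ⊗ g = scale a g ⊕ (ℤ.0ℤ ∷ (f ⊗ g))

⊝_ : Poly → Poly
⊝ f = scale (ℤ.- ℤ.1ℤ) f

qPow : ℕ → Poly
qPow j = replicate j ℤ.0ℤ ++ (ℤ.1ℤ ∷ [])

isZeroPoly : Poly → Bool
isZeroPoly = all (λ a → ⌊ a ℤ.≟ ℤ.0ℤ ⌋)

data Var : Set where
  vx vy : Var

record Letter : Set where
  constructor lt
  field
    var : Var
    idx : ℕ
    inv : Bool          -- true means s_i^{-1}
open Letter public

eqVar : Var → Var → Bool
eqVar vx vx = true
eqVar vy vy = true
eqVar _  _  = false

eqBool : Bool → Bool → Bool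
eqBool a b = (a ∧ b) ∨ (not a ∧ not b)

eqLetter : Letter → Letter → Bool
eqLetter (lt v i e) (lt w j f) = eqVar v w ∧ (i ≡ᵇ j) ∧ eqBool e f

sameGen : Letter → Letter → Bool
sameGen (lt v i _) (lt w j _) = eqVar v w ∧ (i ≡ᵇ j)

inversePair : Letter → Letter → Bool
inversePair a b = sameGen a b ∧ not (eqBool (inv a) (inv b))

-- Words (elements of the free group F(𝕊) are represented by reduced words)
Word : Set
Word = List Letter

eqWord : Word → Word → Bool
eqWord []       []       = true
eqWord (a ∷ u)  (b ∷ v)  = eqLetter a b ∧ eqWord u v
eqWord _        _        = false

push : Letter → Word → Word
push a []      = a ∷ []
push a (b ∷ w) = if inversePair a b then w else a ∷ b ∷ w

reduce : Word → Word
reduce = foldr push []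

_·_ : Word → Word → Word
u · v = reduce (u ++ v)

upL : Letter → Letter
upL (lt v i e) = lt v (suc i) e

up : Word → Word
up = map upL

-- The order DIO:  ⋯ < x₂ < y₂ < x₁ < y₁ < x₀ < y₀,
-- a letter s_i^{-1} ranked as s_i.  leqL a b  means rank a ≤ rank b.

leqL : Letter → Letter → Bool
leqL (lt v i _) (lt w j _) =
  (j <ᵇ i) ∨ ((i ≡ᵇ j) ∧ (eqVar v vx ∨ eqVar w vy))

insertL : Letter → Word → Word
insertL a []      = a ∷ []
insertL a (b ∷ w) = if leqL a b then a ∷ b ∷ w else b ∷ insertL a w

sortL : Word → Word
sortL = foldr insertL []

DIO : Word → Word
DIO w = reduce (sortL w)

-- Elements of 𝔼 = ℤ[q][F(𝕊)] as finite formal sums (not collected).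

E : Set
E = List (Poly × Word)

gen : Letter → Word
gen a = a ∷ []

R⁺ : Var → ℕ → E
R⁺ vx j = (qPow j , []) ∷ (qPow j , lt vx j false ∷ lt vx (suc j) false ∷ []) ∷ []
R⁺ vy j = (qPow j , lt vx j false ∷ lt vy (suc j) false ∷ []) ∷ []

R : Letter → E
R (lt v j false) = R⁺ v j
R (lt v j true)  =
  map (λ { (c , m) → (⊝ c , (gen (lt v j true) · m) · gen (lt v (suc j) true)) }) (R⁺ v j)

Dword : Word → Word → E
Dword pre []      = []
Dword pre (a ∷ w) =
  map (λ { (c , m) → (c , DIO ((pre · m) · up w)) }) (R a)
  ++ Dword (pre ++ (a ∷ [])) w

D : E → E
D = concatMap (λ { (c , w) → map (λ { (c' , m) → (c ⊗ c' , m) }) (Dword [] w) })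

D^ : ℕ → E → E
D^ zero    e = e
D^ (suc n) e = D (D^ n e)

x₀ : E
x₀ = (qPow 0 , gen (lt vx 0 false)) ∷ []

coeff : E → Word → Poly
coeff e w = foldr (λ { (c , m) acc → if eqWord m w then c ⊕ acc else acc }) [] e

dedup : List Word → List Word
dedup []      = []
dedup (w ∷ ws) = if any (eqWord w) ws then dedup ws else w ∷ dedup ws

support : E → List Word
support e = dedup (filter (λ w → ¬? (isZeroPoly (coeff e w) Data.Bool.≟ true)) (map proj₂ e))

Ω : E → ℕ
Ω e = length (support e)

-- Starting from x₀ only the letters x_j occur, and every word met has the form
-- x_{t+1}^p x_t^q.  Since R(x_j) = q^j (1 + x_j x_{j+1}), D sends such a word to
-- the words obtained by deleting or doubling one letter and raising the letters
-- after it by one index; sorted, these have the same form again.  All coefficients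
-- are nonzero polynomials with nonnegative coefficients, so nothing cancels and Ω
-- counts distinct words.  For n ≥ 3 the words of D^n(x₀) form an explicit family:
-- this holds for n = 3 by evaluation, and passes from n to n + 1 because the
-- family at n is mapped into the family at n + 1 and every member of the latter
-- arises from a member of the former.  Listing the family without repetitions and
-- counting it according to the parity of n gives the formula.

module Submission where

open import Defs
open import Data.Bool using (true; false; T; if_then_else_)
open import Data.Bool.Properties using (∧-zeroʳ; ∨-zeroʳ; T-∧; T-∨; T-≡)
import Data.Bool as Bool
open import Data.Bool.ListAction using (any)
open import Data.Empty using (⊥-elim)
open import Data.Integer as ℤ using (ℤ)
open import Data.Integer.Properties using (pos-*)
open import Data.List using (List; []; _∷_; _++_; map; concatMap; length; replicate)
open import Data.List.Properties
  using (++-assoc; ++-identityʳ; length-++; length-map; length-replicate; map-∘; map-id-local;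
         filter-all; map-concatMap; concatMap-cong; concatMap-map)
open import Data.List.Membership.Propositional using (_∈_; _∉_; find; lose)
open import Data.List.Membership.Propositional.Properties
  using (∈-++⁺ˡ; ∈-++⁺ʳ; ∈-++⁻; ∈-map⁺; ∈-map⁻; ∈-concatMap⁺; ∈-concatMap⁻)
open import Data.List.Membership.Propositional.Properties.WithK using (unique∧set⇒bag)
open import Data.List.Relation.Binary.BagAndSetEquality using (∼bag⇒↭)
open import Data.List.Relation.Binary.Permutation.Propositional.Properties using (↭-length)
open import Data.List.Relation.Unary.All as All using (All)
open import Data.List.Relation.Unary.All.Properties using (++⁺; gmap⁺)
open import Data.List.Relation.Unary.Any using (Any; here; there)
open import Data.List.Relation.Unary.Unique.Propositional using (Unique)
import Data.List.Relation.Unary.Unique.Propositional.Properties as Unique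
open import Data.Nat using (ℕ; zero; suc; pred; _+_; _*_; _∸_; _≤_; _<_; s≤s; z≤n; _≡ᵇ_)
open import Data.Nat.Properties
  using (+-suc; +-identityʳ; +-comm; suc-injective; ≤-refl; ≤-reflexive; ≤-trans; ≤-pred; m≤m+n;
         m≤n⇒m≤1+n; m≤n⇒m<n∨m≡n; <-irrefl; <⇒≤; m<n⇒m<1+n; m+n∸m≡n; ≡ᵇ⇒≡)
open import Data.Nat.Tactic.RingSolver using (solve; solve-∀)
open import Data.Product using (_×_; _,_; proj₁; proj₂; ∃; ∃₂; map₂)
open import Data.Sum using (_⊎_; inj₁; inj₂)
open import Function using (_∘_; _⇔_; mk⇔; Equivalence)
open import Function.Properties.Equivalence using () renaming (trans to ⇔-trans; sym to ⇔-sym)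
open import Relation.Binary.Definitions using (DecidableEquality)
open import Relation.Binary.PropositionalEquality
open import Relation.Nullary using (¬_)
open import Relation.Nullary.Decidable using (¬?; map′; T?; toWitness)

open ≡-Reasoning

-- Blocks x_{t+1}^p x_t^q and their images under D

X : ℕ → Letter
X i = lt vx i false

Code : Set
Code = ℕ × ℕ × ℕ

-- Codes are not unique: ⟦ suc t , 0 , q ⟧ = ⟦ t , q , 0 ⟧, and every ⟦ t , 0 , 0 ⟧ is empty.
⟦_⟧ : Code → Word
⟦ t , p , q ⟧ = replicate p (X (suc t)) ++ replicate q (X t)

positions : {A : Set} → (ℕ → ℕ → List A) → ℕ → ℕ → List A
positions f j zero    = []
positions f j (suc r) = f j r ++ positions f (suc j) r

∈-positions⁻ : ∀ {A : Set} (f : ℕ → ℕ → List A) j n {x} → x ∈ positions f j n →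
  ∃₂ λ k r → n ≡ k + suc r × x ∈ f (j + k) r
∈-positions⁻ f j (suc n) {x} x∈ with ∈-++⁻ (f j n) x∈
... | inj₁ x∈f = 0 , n , refl , subst (λ i → x ∈ f i n) (sym (+-identityʳ j)) x∈f
... | inj₂ x∈ps with ∈-positions⁻ f (suc j) n x∈ps
...   | k , r , refl , x∈f = suc k , r , refl , subst (λ i → x ∈ f i r) (sym (+-suc j k)) x∈f

∈-positions⁺ : ∀ {A : Set} (f : ℕ → ℕ → List A) j k r {x} → x ∈ f (j + k) r → x ∈ positions f j (k + suc r)
∈-positions⁺ f j zero    r {x} x∈ = ∈-++⁺ˡ (subst (λ i → x ∈ f i r) (+-identityʳ j) x∈)
∈-positions⁺ f j (suc k) r {x} x∈ =
  ∈-++⁺ʳ (f j (k + suc r)) (∈-positions⁺ f (suc j) k r (subst (λ i → x ∈ f i r) (+-suc j k) x∈))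

topImages : ℕ → ℕ → ℕ → ℕ → List Code
topImages t b k r = (suc t , r , k + b) ∷ (suc t , suc r , suc (k + b)) ∷ []

bottomImages : ℕ → ℕ → ℕ → ℕ → List Code
bottomImages t a k r = (t , a + r , k) ∷ (t , a + suc r , suc k) ∷ []

image : Code → List Code
image (t , a , b) = positions (topImages t b) 0 a ++ positions (bottomImages t a) 0 b

-- The letter with k letters of its block before it and r after it is deleted
-- (term 1 of R) or doubled (term x_j x_{j+1}); the letters after it are raised.
data Image : Code → Code → Set where
  deleteTop    : ∀ {t a b} k r → a ≡ k + suc r → Image (t , a , b) (suc t , r , k + b)
  doubleTop    : ∀ {t a b} k r → a ≡ k + suc r → Image (t , a , b) (suc t , suc r , suc (k + b))
  deleteBottom : ∀ {t a b} k r → b ≡ k + suc r → Image (t , a , b) (t , a + r , k)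
  doubleBottom : ∀ {t a b} k r → b ≡ k + suc r → Image (t , a , b) (t , a + suc r , suc k)

∈-image⁻ : ∀ {t a b d} → d ∈ image (t , a , b) → Image (t , a , b) d
∈-image⁻ {t} {a} {b} d∈ with ∈-++⁻ (positions (topImages t b) 0 a) d∈
... | inj₁ d∈top with ∈-positions⁻ (topImages t b) 0 a d∈top
...   | k , r , a≡ , here refl         = deleteTop k r a≡
...   | k , r , a≡ , there (here refl) = doubleTop k r a≡
∈-image⁻ {t} {a} {b} d∈ | inj₂ d∈bottom with ∈-positions⁻ (bottomImages t a) 0 b d∈bottom
...   | k , r , b≡ , here refl         = deleteBottom k r b≡
...   | k , r , b≡ , there (here refl) = doubleBottom k r b≡

∈-image⁺ : ∀ {c d} → Image c d → d ∈ image c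
∈-image⁺ {t , _ , b} (deleteTop k r refl) =
  ∈-++⁺ˡ (∈-positions⁺ (topImages t b) 0 k r (here refl))
∈-image⁺ {t , _ , b} (doubleTop k r refl) =
  ∈-++⁺ˡ (∈-positions⁺ (topImages t b) 0 k r (there (here refl)))
∈-image⁺ {t , a , b} (deleteBottom k r refl) =
  ∈-++⁺ʳ (positions (topImages t b) 0 a) (∈-positions⁺ (bottomImages t a) 0 k r (here refl))
∈-image⁺ {t , a , b} (doubleBottom k r refl) =
  ∈-++⁺ʳ (positions (topImages t b) 0 a) (∈-positions⁺ (bottomImages t a) 0 k r (there (here refl)))

-- Support n codes the words of D^n(x₀) for n ≥ 3: x_{s+1}^p x_s^q with 1 ≤ s ≤ n - 2
-- and either p, q ≥ 1, p + q = n + 1 or p ≥ 1, p + q = n - 1 - 2m; x₁^p with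
-- p = n - 1 - 2m ≥ 1; x₁ⁿ x₀; xₙ xₙ₋₁ⁿ; and the empty word when n is odd.
data Exponents (n : ℕ) : ℕ × ℕ → Set where
  long  : ∀ {p q} → suc (p + q) ≡ n → Exponents n (suc p , suc q)
  short : ∀ {p q} m → suc (suc (p + q + (m + m))) ≡ n → Exponents n (suc p , q)

data Support (n : ℕ) : Code → Set where
  middle  : ∀ {t p q} → 3 + t ≤ n → Exponents n (p , q) → Support n (suc t , p , q)
  power   : ∀ {p} m → suc (suc (p + (m + m))) ≡ n → Support n (0 , suc p , 0)
  x₁ⁿx₀   : Support n (0 , n , 1)
  xₙxₙ₋₁ⁿ : ∀ {t} → suc t ≡ n → Support n (t , 1 , n)
  empty   : ∀ m → m + m ≡ suc n → Support n (0 , 0 , 0)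

data Supported (n : ℕ) (d : Code) : Set where
  supported-by : ∀ {c} → Support n c → ⟦ d ⟧ ≡ ⟦ c ⟧ → Supported n d

supported : ∀ {n d} → Support n d → Supported n d
supported s = supported-by s refl

⟦⟧-cong : ∀ {t p q p′ q′} → p ≡ p′ → q ≡ q′ → ⟦ t , p , q ⟧ ≡ ⟦ t , p′ , q′ ⟧
⟦⟧-cong refl refl = refl

⟦⟧-pure-power : ∀ t q → ⟦ suc t , 0 , q ⟧ ≡ ⟦ t , q , 0 ⟧
⟦⟧-pure-power t q = sym (++-identityʳ _)

suc-≡-+-suc : ∀ {p} k r → suc p ≡ k + suc r → p ≡ k + r
suc-≡-+-suc k r eq = suc-injective (trans eq (+-suc k r))

0≢+-suc : ∀ {k r} → 0 ≢ k + suc r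
0≢+-suc {k} {r} eq with () ← trans eq (+-suc k r)

1≡+-suc : ∀ {k r} → 1 ≡ k + suc r → k ≡ 0 × r ≡ 0
1≡+-suc {zero}  {zero} refl = refl , refl
1≡+-suc {suc k} {r}    eq with () ← 0≢+-suc {k} {r} (suc-injective eq)

x₁-power : ∀ {N} m j → suc (j + (m + m)) ≡ N → Supported N (1 , 0 , j)
x₁-power m zero    refl = supported-by (empty (suc m) (cong suc (+-suc m m))) refl
x₁-power m (suc j) eq   = supported-by (power m eq) (⟦⟧-pure-power 0 (suc j))

top-power : ∀ {t N} m j → 3 + t ≤ N → suc (j + (m + m)) ≡ N → Supported N (suc (suc t) , 0 , j)
top-power m zero    le refl = supported-by (empty (suc m) (cong suc (+-suc m m))) refl
top-power {t} m (suc j) le eq =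
  supported-by {c = suc t , suc j , 0}
    (middle le (short m (trans (cong (λ i → suc (suc (i + (m + m)))) (+-identityʳ j)) eq)))
               (⟦⟧-pure-power (suc t) (suc j))

no-image-of-empty : ∀ {t d} → ¬ Image (t , 0 , 0) d
no-image-of-empty (deleteTop k r a≡)    = 0≢+-suc a≡
no-image-of-empty (doubleTop k r a≡)    = 0≢+-suc a≡
no-image-of-empty (deleteBottom k r b≡) = 0≢+-suc b≡
no-image-of-empty (doubleBottom k r b≡) = 0≢+-suc b≡

forward-long : ∀ {t p q n d} → 3 + t ≤ n → suc (p + q) ≡ n → Image (suc t , suc p , suc q) d → Supported (suc n) d
forward-long {q = q} le refl (deleteTop k zero eq) with refl ← suc-≡-+-suc k zero eq =
  top-power 0 (k + suc q) (m≤n⇒m≤1+n le) e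
  where e : suc (k + suc q + 0) ≡ suc (suc (k + 0 + q))
        e = solve (k ∷ q ∷ [])
forward-long {q = q} le refl (deleteTop k (suc r) eq) with refl ← suc-≡-+-suc k (suc r) eq =
  supported (middle (s≤s le) (short 0 e))
  where e : suc (suc (r + (k + suc q) + (0 + 0))) ≡ suc (suc (k + suc r + q))
        e = solve (k ∷ r ∷ q ∷ [])
forward-long {q = q} le refl (doubleTop k r eq) with refl ← suc-≡-+-suc k r eq =
  supported (middle (s≤s le) (long e))
  where e : suc (r + (k + suc q)) ≡ suc (suc (k + r + q))
        e = solve (k ∷ r ∷ q ∷ [])
forward-long {p = p} le refl (deleteBottom k r eq) with refl ← suc-≡-+-suc k r eq =
  supported (middle (m≤n⇒m≤1+n le) (short 0 e))
  where e : suc (suc (p + r + k + (0 + 0))) ≡ suc (suc (p + (k + r)))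
        e = solve (p ∷ k ∷ r ∷ [])
forward-long {p = p} le refl (doubleBottom k r eq) with refl ← suc-≡-+-suc k r eq =
  supported (middle (m≤n⇒m≤1+n le) (long e))
  where e : suc (p + suc r + k) ≡ suc (suc (p + (k + r)))
        e = solve (p ∷ k ∷ r ∷ [])

forward-short : ∀ {t p q m n d} → 3 + t ≤ n → suc (suc (p + q + (m + m))) ≡ n →
  Image (suc t , suc p , q) d → Supported (suc n) d
forward-short {q = q} {m} le refl (deleteTop k zero eq) with refl ← suc-≡-+-suc k zero eq =
  top-power (suc m) (k + q) (m≤n⇒m≤1+n le) e
  where e : suc (k + q + (suc m + suc m)) ≡ suc (suc (suc (k + 0 + q + (m + m))))
        e = solve (k ∷ q ∷ m ∷ [])
forward-short {q = q} {m} le refl (deleteTop k (suc r) eq) with refl ← suc-≡-+-suc k (suc r) eq =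
  supported (middle (s≤s le) (short (suc m) e))
  where e : suc (suc (r + (k + q) + (suc m + suc m))) ≡ suc (suc (suc (k + suc r + q + (m + m))))
        e = solve (k ∷ q ∷ r ∷ m ∷ [])
forward-short {q = q} {m} le refl (doubleTop k r eq) with refl ← suc-≡-+-suc k r eq =
  supported (middle (s≤s le) (short m e))
  where e : suc (suc (r + suc (k + q) + (m + m))) ≡ suc (suc (suc (k + r + q + (m + m))))
        e = solve (k ∷ q ∷ r ∷ m ∷ [])
forward-short {p = p} {m = m} le refl (deleteBottom k r refl) =
  supported (middle (m≤n⇒m≤1+n le) (short (suc m) e))
  where e : suc (suc (p + r + k + (suc m + suc m))) ≡ suc (suc (suc (p + (k + suc r) + (m + m))))
        e = solve (p ∷ k ∷ r ∷ m ∷ [])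
forward-short {p = p} {m = m} le refl (doubleBottom k r refl) =
  supported (middle (m≤n⇒m≤1+n le) (short m e))
  where e : suc (suc (p + suc r + suc k + (m + m))) ≡ suc (suc (suc (p + (k + suc r) + (m + m))))
        e = solve (p ∷ k ∷ r ∷ m ∷ [])

forward-power : ∀ {p m n d} → 3 ≤ n → suc (suc (p + (m + m))) ≡ n → Image (0 , suc p , 0) d → Supported (suc n) d
forward-power {m = m} h3 refl (deleteTop k zero eq) with refl ← suc-≡-+-suc k zero eq =
  x₁-power (suc m) (k + 0) e
  where e : suc (k + 0 + (suc m + suc m)) ≡ suc (suc (suc (k + 0 + (m + m))))
        e = solve (k ∷ m ∷ [])
forward-power {m = m} h3 refl (deleteTop k (suc r) eq) with refl ← suc-≡-+-suc k (suc r) eq =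
  supported (middle (m≤n⇒m≤1+n h3) (short (suc m) e))
  where e : suc (suc (r + (k + 0) + (suc m + suc m))) ≡ suc (suc (suc (k + suc r + (m + m))))
        e = solve (k ∷ r ∷ m ∷ [])
forward-power {m = m} h3 refl (doubleTop k r eq) with refl ← suc-≡-+-suc k r eq =
  supported (middle (m≤n⇒m≤1+n h3) (short m e))
  where e : suc (suc (r + suc (k + 0) + (m + m))) ≡ suc (suc (suc (k + r + (m + m))))
        e = solve (k ∷ r ∷ m ∷ [])
forward-power h3 refl (deleteBottom k r eq) with () ← 0≢+-suc eq
forward-power h3 refl (doubleBottom k r eq) with () ← 0≢+-suc eq

forward-x₁ⁿx₀ : ∀ {n d} → 3 ≤ n → Image (0 , n , 1) d → Supported (suc n) d
forward-x₁ⁿx₀ h3 (deleteTop k zero refl) = x₁-power 0 (k + 1) (cong suc (+-identityʳ (k + 1)))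
forward-x₁ⁿx₀ h3 (deleteTop k (suc r) refl) = supported (middle (m≤n⇒m≤1+n h3) (short 0 e))
  where e : suc (suc (r + (k + 1) + (0 + 0))) ≡ suc (k + suc (suc r))
        e = solve (k ∷ r ∷ [])
forward-x₁ⁿx₀ h3 (doubleTop k r refl) = supported (middle (m≤n⇒m≤1+n h3) (long e))
  where e : suc (r + (k + 1)) ≡ suc (k + suc r)
        e = solve (k ∷ r ∷ [])
forward-x₁ⁿx₀ {suc n} h3 (deleteBottom k r eq) with refl , refl ← 1≡+-suc eq =
  supported (power 0 (cong (suc ∘ suc) (trans (+-identityʳ (n + 0)) (+-identityʳ n))))
forward-x₁ⁿx₀ {n} h3 (doubleBottom k r eq) with refl , refl ← 1≡+-suc eq =
  supported-by x₁ⁿx₀ (⟦⟧-cong (+-comm n 1) refl)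

forward-xₙxₙ₋₁ⁿ : ∀ {t n d} → 3 ≤ n → suc t ≡ n → Image (t , 1 , n) d → Supported (suc n) d
forward-xₙxₙ₋₁ⁿ {suc (suc t)} h3 refl (deleteTop k r eq) with refl , refl ← 1≡+-suc eq =
  supported-by {c = suc (suc t) , suc (suc (suc t)) , 0} (middle ≤-refl (short 0 e))
               (⟦⟧-pure-power (suc (suc t)) _)
  where e : suc (suc (suc (suc t) + 0 + (0 + 0))) ≡ suc (suc (suc (suc t)))
        e = solve (t ∷ [])
forward-xₙxₙ₋₁ⁿ {suc (suc t)} h3 refl (doubleTop k r eq) with refl , refl ← 1≡+-suc eq =
  supported (xₙxₙ₋₁ⁿ refl)
forward-xₙxₙ₋₁ⁿ {suc (suc t)} h3 refl (deleteBottom k r eq) =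
  supported (middle ≤-refl (short 0 e))
  where e : suc (suc (r + k + (0 + 0))) ≡ suc (suc (suc (suc t)))
        e = trans arith (cong suc (sym eq))
          where arith : suc (suc (r + k + (0 + 0))) ≡ suc (k + suc r)
                arith = solve (r ∷ k ∷ [])
forward-xₙxₙ₋₁ⁿ {suc (suc t)} h3 refl (doubleBottom k r eq) =
  supported (middle ≤-refl (long e))
  where e : suc (suc r + k) ≡ suc (suc (suc (suc t)))
        e = trans arith (cong suc (sym eq))
          where arith : suc (suc r + k) ≡ suc (k + suc r)
                arith = solve (r ∷ k ∷ [])
forward-xₙxₙ₋₁ⁿ {zero}        (s≤s ()) refl _
forward-xₙxₙ₋₁ⁿ {suc zero}    (s≤s (s≤s ())) refl _

forward : ∀ {n c d} → 3 ≤ n → Support n c → Image c d → Supported (suc n) d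
forward h3 (middle le (long eq))    im = forward-long le eq im
forward h3 (middle le (short m eq)) im = forward-short {m = m} le eq im
forward h3 (power m eq)             im = forward-power {m = m} h3 eq im
forward h3 x₁ⁿx₀                    im = forward-x₁ⁿx₀ h3 im
forward h3 (xₙxₙ₋₁ⁿ eq)             im = forward-xₙxₙ₋₁ⁿ h3 eq im
forward h3 (empty m eq)             im = ⊥-elim (no-image-of-empty im)

data Preimage (n : ℕ) (d : Code) : Set where
  preimage : ∀ {c d′} → Support n c → Image c d′ → ⟦ d′ ⟧ ≡ ⟦ d ⟧ → Preimage n d

interior-or-edge : ∀ {t n} → 3 + t ≤ suc n → 3 + t ≤ n ⊎ n ≡ suc (suc t)
interior-or-edge le with m≤n⇒m<n∨m≡n le
... | inj₁ <n = inj₁ (≤-pred <n)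
... | inj₂ eq = inj₂ (suc-injective (sym eq))

middle-or-xₙxₙ₋₁ⁿ : ∀ {t n} → 3 + t ≤ suc n → Support n (suc t , 1 , n)
middle-or-xₙxₙ₋₁ⁿ {n = suc n} le with interior-or-edge le
... | inj₁ le′  = middle le′ (long refl)
... | inj₂ refl = xₙxₙ₋₁ⁿ refl
middle-or-xₙxₙ₋₁ⁿ {n = zero} (s≤s ())

backward-long : ∀ {t p q n} → 3 + t ≤ suc n → suc (p + q) ≡ suc n → Preimage n (suc t , suc p , suc q)
backward-long {t} {suc p} {q} le refl =
  preimage (middle-or-xₙxₙ₋₁ⁿ le) (doubleBottom q p (+-comm (suc p) q)) refl
backward-long {suc t} {zero} {n = suc n} le refl =
  preimage (middle (≤-pred le) (long refl)) (doubleTop 0 0 refl) refl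
backward-long {zero} {zero} {n = suc n} le refl =
  preimage x₁ⁿx₀ (doubleTop n 0 (+-comm 1 n)) (cong (λ i → ⟦ 1 , 1 , suc i ⟧) (+-comm n 1))
backward-long {p = zero} {n = zero} (s≤s ()) refl

interior-exponents : ∀ {p q n} m → suc (suc (p + q + (m + m))) ≡ suc n → Exponents n (suc p , suc q)
interior-exponents {p} {q} zero refl = long e
  where e : suc (p + q) ≡ suc (p + q + (0 + 0))
        e = solve (p ∷ q ∷ [])
interior-exponents {p} {q} (suc m) refl = short m e
  where e : suc (suc (p + suc q + (m + m))) ≡ suc (p + q + (suc m + suc m))
        e = solve (p ∷ q ∷ m ∷ [])

backward-short-interior : ∀ {t p q m n} → 3 + t ≤ n → suc (suc (p + q + (m + m))) ≡ suc n →
  Preimage n (suc t , suc p , q)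
backward-short-interior {p = p} {q} {m} le eq =
  preimage (middle le (interior-exponents m eq)) (deleteBottom q 0 (+-comm 1 q)) (⟦⟧-cong (+-identityʳ (suc p)) refl)

backward-short-edge : ∀ {t p q m} → 3 ≤ suc (suc t) → suc (suc (p + q + (m + m))) ≡ suc (suc (suc t)) →
  Preimage (suc (suc t)) (suc t , suc p , q)
backward-short-edge {suc t} {p} {zero} {zero} h3 eq =
  preimage (xₙxₙ₋₁ⁿ refl) (deleteBottom 0 (suc (suc t)) refl) (⟦⟧-cong (cong suc (sym p≡)) refl)
  where
  p≡ : p ≡ suc (suc t)
  p≡ = trans (sym (trans (+-identityʳ (p + 0)) (+-identityʳ p))) (suc-injective (suc-injective eq))
backward-short-edge {suc t} {p} {suc q} {zero} h3 eq =
  preimage (middle ≤-refl (long e)) (deleteTop 0 (suc p) refl) refl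
  where e : suc (suc p + q) ≡ suc (suc (suc t))
        e = trans arith (suc-injective eq)
          where arith : suc (suc p + q) ≡ suc (p + suc q + (0 + 0))
                arith = solve (p ∷ q ∷ [])
backward-short-edge {suc t} {p} {q} {suc m} h3 eq =
  preimage (middle ≤-refl (short m e)) (deleteTop 0 (suc p) refl) refl
  where e : suc (suc (suc p + q + (m + m))) ≡ suc (suc (suc t))
        e = trans arith (suc-injective eq)
          where arith : suc (suc (suc p + q + (m + m))) ≡ suc (p + q + (suc m + suc m))
                arith = solve (p ∷ q ∷ m ∷ [])
backward-short-edge {zero} (s≤s (s≤s ())) _

backward-power : ∀ {p m n} → suc (suc (p + (m + m))) ≡ suc n → Preimage n (0 , suc p , 0)
backward-power {p} {zero} refl =
  preimage x₁ⁿx₀ (deleteBottom 0 0 refl)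
           (⟦⟧-cong (trans (+-identityʳ (suc (p + 0))) (cong suc (+-identityʳ p))) refl)
backward-power {p} {suc m} refl =
  preimage (power m e) (deleteTop (suc p) 0 (+-comm 1 (suc p)))
           (trans (cong (λ i → ⟦ 1 , 0 , i ⟧) (+-identityʳ (suc p))) (⟦⟧-pure-power 0 (suc p)))
  where e : suc (suc (suc p + (m + m))) ≡ suc (p + (suc m + suc m))
        e = solve (p ∷ m ∷ [])

backward-empty : ∀ {m n} → 3 ≤ n → m + m ≡ suc (suc n) → Preimage n (0 , 0 , 0)
backward-empty {suc (suc m)} h3 eq = preimage (middle h3 (short m e)) (deleteTop 0 0 refl) refl
  where e : suc (suc (0 + 0 + (m + m))) ≡ _
        e = suc-injective (suc-injective (trans arith eq))
          where arith : suc (suc (suc (suc (m + m)))) ≡ suc (suc m) + suc (suc m)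
                arith = solve (m ∷ [])
backward-empty {zero}     h3 ()
backward-empty {suc zero} () refl

backward : ∀ {n d} → 3 ≤ n → Support (suc n) d → Preimage n d
backward h3 (middle le (long eq)) = backward-long le eq
backward h3 (middle le (short m eq)) with interior-or-edge le
... | inj₁ le′  = backward-short-interior {m = m} le′ eq
... | inj₂ refl = backward-short-edge {m = m} h3 eq
backward h3 (power m eq) = backward-power {m = m} eq
backward {n} h3 x₁ⁿx₀ = preimage x₁ⁿx₀ (doubleBottom 0 0 refl) (⟦⟧-cong (+-comm n 1) refl)
backward {suc n} h3 (xₙxₙ₋₁ⁿ refl) = preimage (xₙxₙ₋₁ⁿ refl) (doubleTop 0 0 refl) refl
backward h3 (empty m eq) = backward-empty {m} h3 eq

diagonal : ℕ → List (ℕ × ℕ)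
diagonal zero    = []
diagonal (suc L) = (suc L , 0) ∷ map (map₂ suc) (diagonal L)

∈-diagonal⁻ : ∀ L {x} → x ∈ diagonal L → ∃₂ λ p q → x ≡ (suc p , q) × suc (p + q) ≡ L
∈-diagonal⁻ (suc L) (here refl) = L , 0 , refl , cong suc (+-identityʳ L)
∈-diagonal⁻ (suc L) (there x∈) with ∈-map⁻ (map₂ suc) x∈
... | y , y∈ , refl with ∈-diagonal⁻ L y∈
...   | p , q , refl , eq = p , suc q , refl , trans (cong suc (+-suc p q)) (cong suc eq)

∈-diagonal⁺ : ∀ p q → (suc p , q) ∈ diagonal (suc (p + q))
∈-diagonal⁺ p zero    = here (cong (λ i → suc i , 0) (sym (+-identityʳ p)))
∈-diagonal⁺ p (suc q) = subst (λ i → (suc p , suc q) ∈ diagonal (suc i)) (sym (+-suc p q))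
                              (there (∈-map⁺ (map₂ suc) (∈-diagonal⁺ p q)))

shortExponents : ℕ → List (ℕ × ℕ)
shortExponents zero          = []
shortExponents (suc zero)    = []
shortExponents (suc (suc n)) = diagonal (suc n) ++ shortExponents n

exponents : ℕ → List (ℕ × ℕ)
exponents n = map (map₂ suc) (diagonal n) ++ shortExponents n

exponents-step : ∀ {n x} → Exponents n x → Exponents (suc (suc n)) x
exponents-step (long {p} {q} refl) = short 0 (cong (suc ∘ suc) (trans (+-identityʳ (p + suc q)) (+-suc p q)))
exponents-step (short {p} {q} m refl) = short (suc m) e
  where e : suc (suc (p + q + (suc m + suc m))) ≡ suc (suc (suc (suc (p + q + (m + m)))))
        e = solve (p ∷ q ∷ m ∷ [])

∈-shortExponents⁻ : ∀ n {x} → x ∈ shortExponents n → Exponents n x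
∈-shortExponents⁻ (suc (suc n)) x∈ with ∈-++⁻ (diagonal (suc n)) x∈
... | inj₂ x∈short = exponents-step (∈-shortExponents⁻ n x∈short)
... | inj₁ x∈diag with ∈-diagonal⁻ (suc n) x∈diag
...   | p , q , refl , refl = short 0 (cong (suc ∘ suc) (+-identityʳ (p + q)))

∈-shortExponents⁺ : ∀ {p q n} m → suc (suc (p + q + (m + m))) ≡ n → (suc p , q) ∈ shortExponents n
∈-shortExponents⁺ {p} {q} zero refl =
  ∈-++⁺ˡ (subst (λ i → (suc p , q) ∈ diagonal (suc i)) (sym (+-identityʳ (p + q))) (∈-diagonal⁺ p q))
∈-shortExponents⁺ {p} {q} (suc m) refl =
  ∈-++⁺ʳ (diagonal _) (subst (λ i → (suc p , q) ∈ shortExponents i) e (∈-shortExponents⁺ m refl))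
  where e : suc (suc (p + q + (m + m))) ≡ p + q + (suc m + suc m)
        e = solve (p ∷ q ∷ m ∷ [])

∈-exponents⁻ : ∀ n {x} → x ∈ exponents n → Exponents n x
∈-exponents⁻ n x∈ with ∈-++⁻ (map (map₂ suc) (diagonal n)) x∈
... | inj₂ x∈short = ∈-shortExponents⁻ n x∈short
... | inj₁ x∈long with ∈-map⁻ (map₂ suc) x∈long
...   | y , y∈ , refl with ∈-diagonal⁻ n y∈
...     | p , q , refl , eq = long eq

∈-exponents⁺ : ∀ {n x} → Exponents n x → x ∈ exponents n
∈-exponents⁺ (long {p} {q} refl) = ∈-++⁺ˡ (∈-map⁺ (map₂ suc) (∈-diagonal⁺ p q))
∈-exponents⁺ (short m eq)        = ∈-++⁺ʳ (map (map₂ suc) (diagonal _)) (∈-shortExponents⁺ m eq)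

middleCodes : ℕ → ℕ → List Code
middleCodes n zero    = []
middleCodes n (suc j) = map (suc j ,_) (exponents n) ++ middleCodes n j

∈-middleCodes⁻ : ∀ n j {c} → c ∈ middleCodes n j → ∃₂ λ t x → c ≡ (suc t , x) × t < j × x ∈ exponents n
∈-middleCodes⁻ n (suc j) c∈ with ∈-++⁻ (map (suc j ,_) (exponents n)) c∈
... | inj₁ c∈j with ∈-map⁻ (suc j ,_) c∈j
...   | x , x∈ , refl = j , x , refl , ≤-refl , x∈
∈-middleCodes⁻ n (suc j) c∈ | inj₂ c∈rest with ∈-middleCodes⁻ n j c∈rest
...   | t , x , refl , t<j , x∈ = t , x , refl , m≤n⇒m≤1+n t<j , x∈

∈-middleCodes⁺ : ∀ n {j t x} → t < j → x ∈ exponents n → (suc t , x) ∈ middleCodes n j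
∈-middleCodes⁺ n {suc j} {t} t<j x∈ with m≤n⇒m<n∨m≡n (≤-pred t<j)
... | inj₁ t<j′ = ∈-++⁺ʳ (map (suc j ,_) (exponents n)) (∈-middleCodes⁺ n t<j′ x∈)
... | inj₂ refl = ∈-++⁺ˡ (∈-map⁺ (suc t ,_) x∈)

powers : ℕ → List Code
powers zero          = []
powers (suc zero)    = []
powers (suc (suc n)) = (0 , suc n , 0) ∷ powers n

∈-powers⁻ : ∀ n {c} → c ∈ powers n → ∃₂ λ p m → c ≡ (0 , suc p , 0) × suc (suc (p + (m + m))) ≡ n
∈-powers⁻ (suc (suc n)) (here refl) = n , 0 , refl , cong (suc ∘ suc) (+-identityʳ n)
∈-powers⁻ (suc (suc n)) (there c∈) with ∈-powers⁻ n c∈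
... | p , m , refl , refl = p , suc m , refl , e
  where e : suc (suc (p + (suc m + suc m))) ≡ suc (suc (suc (suc (p + (m + m)))))
        e = solve (p ∷ m ∷ [])

∈-powers⁺ : ∀ {p n} m → suc (suc (p + (m + m))) ≡ n → (0 , suc p , 0) ∈ powers n
∈-powers⁺ {p} zero refl = here (cong (λ i → 0 , suc i , 0) (sym (+-identityʳ p)))
∈-powers⁺ {p} (suc m) refl = there (subst (λ i → (0 , suc p , 0) ∈ powers i) e (∈-powers⁺ m refl))
  where e : suc (suc (p + (m + m))) ≡ p + (suc m + suc m)
        e = solve (p ∷ m ∷ [])

emptyCode : ℕ → List Code
emptyCode zero          = []
emptyCode (suc zero)    = (0 , 0 , 0) ∷ []
emptyCode (suc (suc n)) = emptyCode n

∈-emptyCode⁻ : ∀ n {c} → c ∈ emptyCode n → c ≡ (0 , 0 , 0) × ∃ λ m → m + m ≡ suc n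
∈-emptyCode⁻ (suc zero)    (here refl) = refl , 1 , refl
∈-emptyCode⁻ (suc (suc n)) c∈ with ∈-emptyCode⁻ n c∈
... | refl , m , eq = refl , suc m , cong suc (trans (+-suc m m) (cong suc eq))

∈-emptyCode⁺ : ∀ {n} m → m + m ≡ suc n → (0 , 0 , 0) ∈ emptyCode n
∈-emptyCode⁺ {suc zero}    (suc zero) refl = here refl
∈-emptyCode⁺ {suc (suc n)} (suc m)    eq   = ∈-emptyCode⁺ m (suc-injective (trans (sym (+-suc m m)) (suc-injective eq)))
∈-emptyCode⁺ {zero}        (suc zero) ()
∈-emptyCode⁺ {zero}        (suc (suc m)) ()
∈-emptyCode⁺ {suc zero}    (suc (suc m)) eq
  with () ← trans (sym (+-suc m (suc m))) (suc-injective (suc-injective eq))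

bottomCodes : ℕ → List Code
bottomCodes n = (0 , n , 1) ∷ powers n ++ emptyCode n

codes : ℕ → List Code
codes n = (n ∸ 1 , 1 , n) ∷ middleCodes n (n ∸ 2) ++ bottomCodes n

∈-codes⁻ : ∀ {n c} → 2 ≤ n → c ∈ codes n → Support n c
∈-codes⁻ {suc (suc n)} _ (here refl) = xₙxₙ₋₁ⁿ refl
∈-codes⁻ {suc (suc n)} _ (there c∈) with ∈-++⁻ (middleCodes (suc (suc n)) n) c∈
... | inj₁ c∈middle with ∈-middleCodes⁻ (suc (suc n)) n c∈middle
...   | t , x , refl , t<n , x∈ = middle (s≤s (s≤s t<n)) (∈-exponents⁻ _ x∈)
∈-codes⁻ {suc (suc n)} _ (there c∈) | inj₂ (here refl) = x₁ⁿx₀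
∈-codes⁻ {suc (suc n)} _ (there c∈) | inj₂ (there c∈rest) with ∈-++⁻ (powers (suc (suc n))) c∈rest
... | inj₁ c∈powers with ∈-powers⁻ (suc (suc n)) c∈powers
...   | p , m , refl , eq = power m eq
∈-codes⁻ {suc (suc n)} _ (there c∈) | inj₂ (there c∈rest) | inj₂ c∈empty with ∈-emptyCode⁻ (suc (suc n)) c∈empty
...   | refl , m , eq = empty m eq
∈-codes⁻ {suc zero} (s≤s ()) _

∈-codes⁺ : ∀ {n c} → Support n c → c ∈ codes n
∈-codes⁺ {suc (suc n)} (middle le ex) =
  there (∈-++⁺ˡ (∈-middleCodes⁺ _ (≤-pred (≤-pred le)) (∈-exponents⁺ ex)))
∈-codes⁺ {zero}     (middle () _)
∈-codes⁺ {suc zero} (middle (s≤s ()) _)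
∈-codes⁺ {n} (power m eq) =
  there (∈-++⁺ʳ (middleCodes n (n ∸ 2)) (there (∈-++⁺ˡ (∈-powers⁺ m eq))))
∈-codes⁺ {n} x₁ⁿx₀ = there (∈-++⁺ʳ (middleCodes n (n ∸ 2)) (here refl))
∈-codes⁺ (xₙxₙ₋₁ⁿ refl) = here refl
∈-codes⁺ {n} (empty m eq) =
  there (∈-++⁺ʳ (middleCodes n (n ∸ 2)) (there (∈-++⁺ʳ (powers n) (∈-emptyCode⁺ m eq))))

leqL-X-refl : ∀ i → leqL (X i) (X i) ≡ true
leqL-X-refl zero    = refl
leqL-X-refl (suc i) = leqL-X-refl i

leqL-X-suc-X : ∀ i → leqL (X (suc i)) (X i) ≡ true
leqL-X-suc-X zero    = refl
leqL-X-suc-X (suc i) = leqL-X-suc-X i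

leqL-X-X-suc : ∀ i → leqL (X i) (X (suc i)) ≡ false
leqL-X-X-suc zero    = refl
leqL-X-X-suc (suc i) = leqL-X-X-suc i

insertL-top : ∀ t p q → insertL (X (suc t)) ⟦ t , p , q ⟧ ≡ ⟦ t , suc p , q ⟧
insertL-top t (suc p) q rewrite leqL-X-refl (suc t) = refl
insertL-top t zero (suc q) rewrite leqL-X-suc-X t = refl
insertL-top t zero zero = refl

insertL-bottom : ∀ t p q → insertL (X t) ⟦ t , p , q ⟧ ≡ ⟦ t , p , suc q ⟧
insertL-bottom t (suc p) q rewrite leqL-X-X-suc t = cong (X (suc t) ∷_) (insertL-bottom t p q)
insertL-bottom t zero (suc q) rewrite leqL-X-refl t = refl
insertL-bottom t zero zero = refl

data Shuffle (t : ℕ) : ℕ → ℕ → Word → Set where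
  []     : Shuffle t 0 0 []
  top    : ∀ {p q w} → Shuffle t p q w → Shuffle t (suc p) q (X (suc t) ∷ w)
  bottom : ∀ {p q w} → Shuffle t p q w → Shuffle t p (suc q) (X t ∷ w)

sortL-shuffle : ∀ {t p q w} → Shuffle t p q w → sortL w ≡ ⟦ t , p , q ⟧
sortL-shuffle {t} []                  = refl
sortL-shuffle {t} (top {p} {q} s)    = trans (cong (insertL _) (sortL-shuffle s)) (insertL-top t p q)
sortL-shuffle {t} (bottom {p} {q} s) = trans (cong (insertL _) (sortL-shuffle s)) (insertL-bottom t p q)

shuffle-++ : ∀ {t p q p′ q′ u v} → Shuffle t p q u → Shuffle t p′ q′ v → Shuffle t (p + p′) (q + q′) (u ++ v)
shuffle-++ []          sv = sv
shuffle-++ (top su)    sv = top (shuffle-++ su sv)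
shuffle-++ (bottom su) sv = bottom (shuffle-++ su sv)

shuffle-bottoms : ∀ t q → Shuffle t 0 q (replicate q (X t))
shuffle-bottoms t zero    = []
shuffle-bottoms t (suc q) = bottom (shuffle-bottoms t q)

shuffle-⟦⟧ : ∀ t p q → Shuffle t p q ⟦ t , p , q ⟧
shuffle-⟦⟧ t zero    q = shuffle-bottoms t q
shuffle-⟦⟧ t (suc p) q = top (shuffle-⟦⟧ t p q)

shuffle-up : ∀ {t p q w} → Shuffle t p q w → Shuffle (suc t) p q (up w)
shuffle-up []         = []
shuffle-up (top s)    = top (shuffle-up s)
shuffle-up (bottom s) = bottom (shuffle-up s)

shuffle-up-bottoms : ∀ {t q w} → Shuffle t 0 q w → Shuffle t q 0 (up w)
shuffle-up-bottoms []         = []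
shuffle-up-bottoms (bottom s) = top (shuffle-up-bottoms s)

shuffle-snoc-top : ∀ {t p q w} → Shuffle t p q w → Shuffle t (suc p) q (w ++ X (suc t) ∷ [])
shuffle-snoc-top []         = top []
shuffle-snoc-top (top s)    = top (shuffle-snoc-top s)
shuffle-snoc-top (bottom s) = bottom (shuffle-snoc-top s)

shuffle-snoc-bottom : ∀ {t p q w} → Shuffle t p q w → Shuffle t p (suc q) (w ++ X t ∷ [])
shuffle-snoc-bottom []         = bottom []
shuffle-snoc-bottom (top s)    = top (shuffle-snoc-bottom s)
shuffle-snoc-bottom (bottom s) = bottom (shuffle-snoc-bottom s)

-- Opened only from here on: the ring solver cannot read variable lists
-- built with overloaded constructors.
open import Data.List.Relation.Unary.All using ([]; _∷_)
open import Data.List.Relation.Unary.AllPairs using ([]; _∷_)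

Positive : Word → Set
Positive = All (λ a → inv a ≡ false)

shuffle-positive : ∀ {t p q w} → Shuffle t p q w → Positive w
shuffle-positive []         = []
shuffle-positive (top s)    = refl ∷ shuffle-positive s
shuffle-positive (bottom s) = refl ∷ shuffle-positive s

reduce-positive : ∀ {w} → Positive w → reduce w ≡ w
reduce-positive []                   = refl
reduce-positive (_ ∷ [])             = refl
reduce-positive {a ∷ b ∷ w} (refl ∷ pbw@(refl ∷ _))
  rewrite reduce-positive pbw | ∧-zeroʳ (sameGen a b) = refl

·-positive : ∀ {u v} → Positive u → Positive v → u · v ≡ u ++ v
·-positive pu pv = reduce-positive (++⁺ pu pv)

DIO-shuffle : ∀ {t p q w} → Shuffle t p q w → DIO w ≡ ⟦ t , p , q ⟧
DIO-shuffle {t} {p} {q} s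
  rewrite sortL-shuffle s = reduce-positive (shuffle-positive (shuffle-⟦⟧ t p q))

DIO-shuffle₃ : ∀ {t p q p′ q′ p″ q″ u v w} →
  Shuffle t p q u → Shuffle t p′ q′ v → Shuffle t p″ q″ w →
  DIO ((u · v) · w) ≡ ⟦ t , p + (p′ + p″) , q + (q′ + q″) ⟧
DIO-shuffle₃ {u = u} {v} {w} su sv sw
  rewrite ·-positive (shuffle-positive su) (shuffle-positive sv)
        | ·-positive (shuffle-positive (shuffle-++ su sv)) (shuffle-positive sw)
        | ++-assoc u v w = DIO-shuffle (shuffle-++ su (shuffle-++ sv sw))

words : E → List Word
words = map proj₂

words-Dword-bottoms : ∀ {t a j pre} → Shuffle t a j pre → ∀ r →
  words (Dword pre (replicate r (X t))) ≡ map ⟦_⟧ (positions (bottomImages t a) j r)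
words-Dword-bottoms         s zero    = refl
words-Dword-bottoms {t} {a} {j} {pre} s (suc r) =
  cong₂ _∷_ delete (cong₂ _∷_ double (words-Dword-bottoms (shuffle-snoc-bottom s) r))
  where
  suffix : Shuffle t r 0 (up (replicate r (X t)))
  suffix = shuffle-up-bottoms (shuffle-bottoms t r)
  delete : DIO ((pre · []) · up (replicate r (X t))) ≡ ⟦ t , a + r , j ⟧
  delete = trans (DIO-shuffle₃ s [] suffix) (cong (λ q → ⟦ t , a + r , q ⟧) (+-identityʳ j))
  double : DIO ((pre · (X t ∷ X (suc t) ∷ [])) · up (replicate r (X t))) ≡ ⟦ t , a + suc r , suc j ⟧
  double = trans (DIO-shuffle₃ s (bottom (top [])) suffix) (cong (λ q → ⟦ t , a + suc r , q ⟧) (+-comm j 1))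

-- The prefix x_{t+1}^i is the bottom block at level t + 1 and the top block at level t.
words-Dword-tops : ∀ {t i pre} → Shuffle (suc t) 0 i pre → Shuffle t i 0 pre → ∀ r b →
  words (Dword pre ⟦ t , r , b ⟧) ≡
  map ⟦_⟧ (positions (topImages t b) i r ++ positions (bottomImages t (i + r)) 0 b)
words-Dword-tops {t} {i} s s′ zero b
  rewrite +-identityʳ i = words-Dword-bottoms s′ b
words-Dword-tops {t} {i} {pre} s s′ (suc r) b =
  cong₂ _∷_ delete (cong₂ _∷_ double (trans
    (words-Dword-tops (shuffle-snoc-bottom s) (shuffle-snoc-top s′) r b)
    (cong (λ a → map ⟦_⟧ (positions (topImages t b) (suc i) r ++ positions (bottomImages t a) 0 b))
          (sym (+-suc i r)))))
  where
  suffix : Shuffle (suc t) r b (up ⟦ t , r , b ⟧)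
  suffix = shuffle-up (shuffle-⟦⟧ t r b)
  delete : DIO ((pre · []) · up ⟦ t , r , b ⟧) ≡ ⟦ suc t , r , i + b ⟧
  delete = DIO-shuffle₃ s [] suffix
  double : DIO ((pre · (X (suc t) ∷ X (suc (suc t)) ∷ [])) · up ⟦ t , r , b ⟧) ≡ ⟦ suc t , suc r , suc (i + b) ⟧
  double = trans (DIO-shuffle₃ s (bottom (top [])) suffix) (cong (λ q → ⟦ suc t , suc r , q ⟧) (+-suc i b))

words-Dword-⟦⟧ : ∀ c → words (Dword [] ⟦ c ⟧) ≡ map ⟦_⟧ (image c)
words-Dword-⟦⟧ (t , a , b) = words-Dword-tops [] [] a b

-- Positivity of the coefficients

data NonNeg : ℤ → Set where
  nonNeg : ∀ n → NonNeg (ℤ.+ n)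

data Pos : ℤ → Set where
  pos : ∀ n → Pos (ℤ.+ suc n)

PosPoly : Poly → Set
PosPoly f = All NonNeg f × Any Pos f

⊕-nonNeg : ∀ {f g} → All NonNeg f → All NonNeg g → All NonNeg (f ⊕ g)
⊕-nonNeg {[]}    _  ng = ng
⊕-nonNeg {_ ∷ _} {[]} nf _ = nf
⊕-nonNeg (nonNeg m ∷ nf) (nonNeg n ∷ ng) = nonNeg (m + n) ∷ ⊕-nonNeg nf ng

⊕-posˡ : ∀ {f g} → Any Pos f → All NonNeg g → Any Pos (f ⊕ g)
⊕-posˡ (here (pos m)) []             = here (pos m)
⊕-posˡ (here (pos m)) (nonNeg n ∷ _) = here (pos (m + n))
⊕-posˡ (there pf)     []             = there pf
⊕-posˡ (there pf)     (_ ∷ ng)       = there (⊕-posˡ pf ng)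

⊕-posʳ : ∀ {f g} → All NonNeg f → Any Pos g → Any Pos (f ⊕ g)
⊕-posʳ {[]} _ pg = pg
⊕-posʳ (nonNeg m ∷ _) (here (pos n)) = here (subst Pos (cong ℤ.+_ (sym (+-suc m n))) (pos (m + n)))
⊕-posʳ (_ ∷ nf)       (there pg)     = there (⊕-posʳ nf pg)

scale-nonNeg : ∀ m {g} → All NonNeg g → All NonNeg (scale (ℤ.+ m) g)
scale-nonNeg m []              = []
scale-nonNeg m (nonNeg n ∷ ng) = subst NonNeg (pos-* m n) (nonNeg (m * n)) ∷ scale-nonNeg m ng

scale-pos : ∀ m {g} → Any Pos g → Any Pos (scale (ℤ.+ suc m) g)
scale-pos m (here (pos n)) = here (subst Pos (pos-* (suc m) (suc n)) (pos (n + m * suc n)))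
scale-pos m (there pg)     = there (scale-pos m pg)

⊗-nonNeg : ∀ {f g} → All NonNeg f → All NonNeg g → All NonNeg (f ⊗ g)
⊗-nonNeg []              ng = []
⊗-nonNeg (nonNeg m ∷ nf) ng = ⊕-nonNeg (scale-nonNeg m ng) (nonNeg 0 ∷ ⊗-nonNeg nf ng)

⊗-pos : ∀ {f g} → All NonNeg f → Any Pos f → All NonNeg g → Any Pos g → Any Pos (f ⊗ g)
⊗-pos (nonNeg _ ∷ nf) (here (pos m)) ng pg =
  ⊕-posˡ (scale-pos m pg) (nonNeg 0 ∷ ⊗-nonNeg nf ng)
⊗-pos (nonNeg m ∷ nf) (there pf)     ng pg =
  ⊕-posʳ (scale-nonNeg m ng) (there (⊗-pos nf pf ng pg))

⊗-posPoly : ∀ {f g} → PosPoly f → PosPoly g → PosPoly (f ⊗ g)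
⊗-posPoly (nf , pf) (ng , pg) = ⊗-nonNeg nf ng , ⊗-pos nf pf ng pg

qPow-posPoly : ∀ j → PosPoly (qPow j)
qPow-posPoly zero    = (nonNeg 1 ∷ []) , here (pos 0)
qPow-posPoly (suc j) = let nf , pf = qPow-posPoly j in (nonNeg 0 ∷ nf) , there pf

isZeroPoly-pos : ∀ {f} → Any Pos f → isZeroPoly f ≡ false
isZeroPoly-pos (here (pos n))       = refl
isZeroPoly-pos {a ∷ _} (there pf) rewrite isZeroPoly-pos pf = ∧-zeroʳ _

push-all : ∀ {P : Letter → Set} {a w} → P a → All P w → All P (push a w)
push-all {w = []}    pa []        = pa ∷ []
push-all {a = a} {b ∷ w} pa (pb ∷ pw) with inversePair a b
... | true  = pw
... | false = pa ∷ pb ∷ pw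

reduce-all : ∀ {P : Letter → Set} {w} → All P w → All P (reduce w)
reduce-all []        = []
reduce-all (pa ∷ pw) = push-all pa (reduce-all pw)

insertL-all : ∀ {P : Letter → Set} {a w} → P a → All P w → All P (insertL a w)
insertL-all {w = []}    pa []        = pa ∷ []
insertL-all {a = a} {b ∷ w} pa (pb ∷ pw) with leqL a b
... | true  = pa ∷ pb ∷ pw
... | false = pb ∷ insertL-all pa pw

sortL-all : ∀ {P : Letter → Set} {w} → All P w → All P (sortL w)
sortL-all []        = []
sortL-all (pa ∷ pw) = insertL-all pa (sortL-all pw)

·-all : ∀ {P : Letter → Set} {u v} → All P u → All P v → All P (u · v)
·-all pu pv = reduce-all (++⁺ pu pv)

up-positive : ∀ {w} → Positive w → Positive (up w)
up-positive []        = []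
up-positive (p ∷ ps) = p ∷ up-positive ps

PositiveTerms : E → Set
PositiveTerms = All (λ (c , w) → PosPoly c × Positive w)

R-positiveTerms : ∀ {a} → inv a ≡ false → PositiveTerms (R a)
R-positiveTerms {lt vx j false} refl = (qPow-posPoly j , []) ∷ (qPow-posPoly j , refl ∷ refl ∷ []) ∷ []
R-positiveTerms {lt vy j false} refl = (qPow-posPoly j , refl ∷ refl ∷ []) ∷ []

Dword-positiveTerms : ∀ {pre w} → Positive pre → Positive w → PositiveTerms (Dword pre w)
Dword-positiveTerms {pre} {a ∷ w} ppre (pa ∷ pw) =
  ++⁺ (gmap⁺ (λ (pc , pm) → pc , reduce-all (sortL-all (·-all (·-all ppre pm) (up-positive pw)))) (R-positiveTerms pa))
      (Dword-positiveTerms (++⁺ ppre (pa ∷ [])) pw)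
Dword-positiveTerms {w = []} _ [] = []

D-positiveTerms : ∀ {e} → PositiveTerms e → PositiveTerms (D e)
D-positiveTerms []                       = []
D-positiveTerms ((pc , pw) ∷ pe) =
  ++⁺ (gmap⁺ (λ (pc′ , pm) → ⊗-posPoly pc pc′ , pm) (Dword-positiveTerms [] pw)) (D-positiveTerms pe)

D^-positiveTerms : ∀ n → PositiveTerms (D^ n x₀)
D^-positiveTerms zero    = (qPow-posPoly 0 , refl ∷ []) ∷ []
D^-positiveTerms (suc n) = D-positiveTerms (D^-positiveTerms n)

words-D : ∀ e → words (D e) ≡ concatMap (words ∘ Dword []) (words e)
words-D e = begin
  words (D e)
    ≡⟨ map-concatMap proj₂ _ e ⟩
  concatMap (λ (c , w) → words (map (λ (c′ , m) → (c ⊗ c′ , m)) (Dword [] w))) e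
    ≡⟨ concatMap-cong (λ (c , w) → sym (map-∘ (Dword [] w))) e ⟩
  concatMap (words ∘ Dword [] ∘ proj₂) e
    ≡⟨ concatMap-map (words ∘ Dword []) proj₂ e ⟨
  concatMap (words ∘ Dword []) (words e) ∎

∈-words-D⁻ : ∀ {e w} → w ∈ words (D e) → ∃ λ v → v ∈ words e × w ∈ words (Dword [] v)
∈-words-D⁻ {e} {w} w∈ = find (∈-concatMap⁻ (words ∘ Dword []) (subst (w ∈_) (words-D e) w∈))

∈-words-D⁺ : ∀ {e v w} → v ∈ words e → w ∈ words (Dword [] v) → w ∈ words (D e)
∈-words-D⁺ {e} {w = w} v∈ w∈ = subst (w ∈_) (sym (words-D e)) (∈-concatMap⁺ (words ∘ Dword []) (lose v∈ w∈))

eqVar-refl : ∀ v → eqVar v v ≡ true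
eqVar-refl vx = refl
eqVar-refl vy = refl

eqBool-refl : ∀ b → eqBool b b ≡ true
eqBool-refl true  = refl
eqBool-refl false = refl

eqVar-sound : ∀ v w → T (eqVar v w) → v ≡ w
eqVar-sound vx vx _ = refl
eqVar-sound vy vy _ = refl

eqBool-sound : ∀ a b → T (eqBool a b) → a ≡ b
eqBool-sound true  true  _ = refl
eqBool-sound false false _ = refl

≡ᵇ-refl : ∀ i → (i ≡ᵇ i) ≡ true
≡ᵇ-refl zero    = refl
≡ᵇ-refl (suc i) = ≡ᵇ-refl i

≡ᵇ-suc : ∀ i → (i ≡ᵇ suc i) ≡ false
≡ᵇ-suc zero    = refl
≡ᵇ-suc (suc i) = ≡ᵇ-suc i

eqWord-refl : ∀ w → eqWord w w ≡ true
eqWord-refl []             = refl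
eqWord-refl (lt v i e ∷ w)
  rewrite eqVar-refl v | ≡ᵇ-refl i | eqBool-refl e = eqWord-refl w

eqWord-sound : ∀ u v → T (eqWord u v) → u ≡ v
eqWord-sound []             []              _ = refl
eqWord-sound (lt v i e ∷ u) (lt w j f ∷ u′) h
  with Equivalence.to T-∧ h
... | h₁ , hu with Equivalence.to T-∧ h₁
... | hv , h₂ with Equivalence.to T-∧ h₂
... | hi , he with eqVar-sound v w hv | ≡ᵇ⇒≡ i j hi | eqBool-sound e f he | eqWord-sound u u′ hu
... | refl | refl | refl | refl = refl

any-eqWord⁺ : ∀ {w ws} → w ∈ ws → any (eqWord w) ws ≡ true
any-eqWord⁺ {w} (here refl) rewrite eqWord-refl w = refl
any-eqWord⁺ (there w∈)      rewrite any-eqWord⁺ w∈ = ∨-zeroʳ _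

any-eqWord⁻ : ∀ w ws → T (any (eqWord w) ws) → w ∈ ws
any-eqWord⁻ w (v ∷ ws) h with Equivalence.to T-∨ h
... | inj₁ w≡v = here (eqWord-sound w v w≡v)
... | inj₂ w∈  = there (any-eqWord⁻ w ws w∈)

∈-dedup⁻ : ∀ {x} ws → x ∈ dedup ws → x ∈ ws
∈-dedup⁻ (w ∷ ws) x∈ with any (eqWord w) ws
∈-dedup⁻ (w ∷ ws) x∈          | true  = there (∈-dedup⁻ ws x∈)
∈-dedup⁻ (w ∷ ws) (here refl) | false = here refl
∈-dedup⁻ (w ∷ ws) (there x∈)  | false = there (∈-dedup⁻ ws x∈)

∈-dedup⁺ : ∀ {x} ws → x ∈ ws → x ∈ dedup ws
∈-dedup⁺ (w ∷ ws) x∈ with any (eqWord w) ws in eq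
∈-dedup⁺ (w ∷ ws) (here refl) | true  = ∈-dedup⁺ ws (any-eqWord⁻ w ws (Equivalence.from T-≡ eq))
∈-dedup⁺ (w ∷ ws) (there x∈)  | true  = ∈-dedup⁺ ws x∈
∈-dedup⁺ (w ∷ ws) (here refl) | false = here refl
∈-dedup⁺ (w ∷ ws) (there x∈)  | false = there (∈-dedup⁺ ws x∈)

dedup-unique : ∀ ws → Unique (dedup ws)
dedup-unique []       = []
dedup-unique (w ∷ ws) with any (eqWord w) ws in eq
... | true  = dedup-unique ws
... | false = All.tabulate (λ { v∈ refl → w∉ws (∈-dedup⁻ ws v∈) }) ∷ dedup-unique ws
  where
  w∉ws : w ∉ ws
  w∉ws w∈ with () ← trans (sym (any-eqWord⁺ w∈)) eq

coeff-nonNeg : ∀ {e} w → PositiveTerms e → All NonNeg (coeff e w)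
coeff-nonNeg w [] = []
coeff-nonNeg {(c , m) ∷ e} w (((nc , _) , _) ∷ pe) with eqWord m w
... | true  = ⊕-nonNeg nc (coeff-nonNeg w pe)
... | false = coeff-nonNeg w pe

coeff-pos : ∀ {e w} → PositiveTerms e → w ∈ words e → Any Pos (coeff e w)
coeff-pos {(c , m) ∷ e} (((_ , pc) , _) ∷ pe) (here refl)
  rewrite eqWord-refl m = ⊕-posˡ pc (coeff-nonNeg m pe)
coeff-pos {(c , m) ∷ e} {w} (((nc , _) , _) ∷ pe) (there w∈) with eqWord m w
... | true  = ⊕-posʳ nc (coeff-pos pe w∈)
... | false = coeff-pos pe w∈

support-positiveTerms : ∀ {e} → PositiveTerms e → support e ≡ dedup (words e)
support-positiveTerms {e} pe =
  cong dedup (filter-all (λ w → ¬? (isZeroPoly (coeff e w) Bool.≟ true)) (All.tabulate nonzero))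
  where
  nonzero : ∀ {w} → w ∈ words e → ¬ isZeroPoly (coeff e w) ≡ true
  nonzero w∈ z with () ← trans (sym (isZeroPoly-pos (coeff-pos pe w∈))) z

Ω-positiveTerms : ∀ {e ws} → PositiveTerms e → Unique ws → (∀ {w} → w ∈ words e ⇔ w ∈ ws) → Ω e ≡ length ws
Ω-positiveTerms {e} {ws} pe ws! words⇔ws = begin
  Ω e                      ≡⟨ cong length (support-positiveTerms pe) ⟩
  length (dedup (words e)) ≡⟨ ↭-length (∼bag⇒↭ (unique∧set⇒bag (dedup-unique (words e)) ws! dedup⇔ws)) ⟩
  length ws                ∎
  where
  dedup⇔ws : ∀ {w} → w ∈ dedup (words e) ⇔ w ∈ ws
  dedup⇔ws = mk⇔ (Equivalence.to words⇔ws ∘ ∈-dedup⁻ (words e))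
                 (∈-dedup⁺ (words e) ∘ Equivalence.from words⇔ws)

total : ℕ × ℕ → ℕ
total (p , q) = p + q

total-diagonal : ∀ L {x} → x ∈ diagonal L → total x ≡ L
total-diagonal L x∈ with ∈-diagonal⁻ L x∈
... | p , q , refl , eq = eq

total-shortExponents : ∀ n {x} → x ∈ shortExponents n → total x < n
total-shortExponents (suc (suc n)) x∈ with ∈-++⁻ (diagonal (suc n)) x∈
... | inj₁ x∈diag  = ≤-reflexive (cong suc (total-diagonal (suc n) x∈diag))
... | inj₂ x∈short = m<n⇒m<1+n (m<n⇒m<1+n (total-shortExponents n x∈short))

map₂-suc-injective : ∀ {x y : ℕ × ℕ} → map₂ suc x ≡ map₂ suc y → x ≡ y
map₂-suc-injective {_ , _} {_ , _} refl = refl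

diagonal-unique : ∀ L → Unique (diagonal L)
diagonal-unique zero    = []
diagonal-unique (suc L) = All.tabulate head∉ ∷ Unique.map⁺ map₂-suc-injective (diagonal-unique L)
  where
  head∉ : ∀ {y} → y ∈ map (map₂ suc) (diagonal L) → (suc L , 0) ≢ y
  head∉ y∈ eq with ∈-map⁻ (map₂ suc) y∈
  ... | _ , _ , refl with () ← eq

shortExponents-unique : ∀ n → Unique (shortExponents n)
shortExponents-unique zero          = []
shortExponents-unique (suc zero)    = []
shortExponents-unique (suc (suc n)) =
  Unique.++⁺ (diagonal-unique (suc n)) (shortExponents-unique n)
    λ (x∈diag , x∈short) → <-irrefl (total-diagonal (suc n) x∈diag) (m<n⇒m<1+n (total-shortExponents n x∈short))

exponents-unique : ∀ n → Unique (exponents n)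
exponents-unique n =
  Unique.++⁺ (Unique.map⁺ map₂-suc-injective (diagonal-unique n)) (shortExponents-unique n) long∉short
  where
  long∉short : ∀ {x} → ¬ (x ∈ map (map₂ suc) (diagonal n) × x ∈ shortExponents n)
  long∉short (x∈long , x∈short) with ∈-map⁻ (map₂ suc) x∈long
  ... | (p , q) , y∈ , refl =
    <-irrefl (trans (+-suc p q) (cong suc (total-diagonal n y∈))) (m<n⇒m<1+n (total-shortExponents n x∈short))

middleCodes-unique : ∀ n j → Unique (middleCodes n j)
middleCodes-unique n zero    = []
middleCodes-unique n (suc j) =
  Unique.++⁺ (Unique.map⁺ (cong proj₂) (exponents-unique n)) (middleCodes-unique n j) new∉old
  where
  new∉old : ∀ {c} → ¬ (c ∈ map (suc j ,_) (exponents n) × c ∈ middleCodes n j)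
  new∉old (c∈new , c∈old) with ∈-map⁻ (suc j ,_) c∈new | ∈-middleCodes⁻ n j c∈old
  ... | _ , _ , refl | t , _ , refl , t<j , _ = <-irrefl refl t<j

powers-unique : ∀ n → Unique (powers n)
powers-unique zero          = []
powers-unique (suc zero)    = []
powers-unique (suc (suc n)) = All.tabulate head∉ ∷ powers-unique n
  where
  head∉ : ∀ {c} → c ∈ powers n → (0 , suc n , 0) ≢ c
  head∉ c∈ refl with ∈-powers⁻ n c∈
  ... | p , m , refl , eq = <-irrefl (sym eq) (s≤s (m≤n⇒m≤1+n (m≤m+n p (m + m))))

emptyCode-unique : ∀ n → Unique (emptyCode n)
emptyCode-unique zero          = []
emptyCode-unique (suc zero)    = [] ∷ []
emptyCode-unique (suc (suc n)) = emptyCode-unique n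

bottomCodes-bottom : ∀ n {c} → c ∈ bottomCodes n → proj₁ c ≡ 0
bottomCodes-bottom n (here refl) = refl
bottomCodes-bottom n (there c∈) with ∈-++⁻ (powers n) c∈
... | inj₁ c∈powers with ∈-powers⁻ n c∈powers
...   | _ , _ , refl , _ = refl
bottomCodes-bottom n (there c∈) | inj₂ c∈empty with ∈-emptyCode⁻ n c∈empty
...   | refl , _ = refl

bottomCodes-unique : ∀ n → Unique (bottomCodes n)
bottomCodes-unique n = All.tabulate head∉ ∷ Unique.++⁺ (powers-unique n) (emptyCode-unique n) powers∉empty
  where
  head∉ : ∀ {c} → c ∈ powers n ++ emptyCode n → (0 , n , 1) ≢ c
  head∉ c∈ refl with ∈-++⁻ (powers n) c∈
  ... | inj₁ c∈powers with () ← ∈-powers⁻ n c∈powers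
  ... | inj₂ c∈empty  with () ← ∈-emptyCode⁻ n c∈empty
  powers∉empty : ∀ {c} → ¬ (c ∈ powers n × c ∈ emptyCode n)
  powers∉empty (c∈powers , c∈empty) with ∈-powers⁻ n c∈powers | ∈-emptyCode⁻ n c∈empty
  ... | _ , _ , refl , _ | () , _

codes-unique : ∀ {n} → 2 ≤ n → Unique (codes n)
codes-unique {suc (suc n)} _ =
  All.tabulate head∉ ∷ Unique.++⁺ (middleCodes-unique _ n) (bottomCodes-unique _) middle∉bottom
  where
  middle∉bottom : ∀ {c} → ¬ (c ∈ middleCodes (suc (suc n)) n × c ∈ bottomCodes (suc (suc n)))
  middle∉bottom (c∈middle , c∈bottom) with ∈-middleCodes⁻ _ n c∈middle
  ... | _ , _ , refl , _ , _ with () ← bottomCodes-bottom _ c∈bottom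
  head∉ : ∀ {c} → c ∈ middleCodes (suc (suc n)) n ++ bottomCodes (suc (suc n)) → (suc n , 1 , suc (suc n)) ≢ c
  head∉ c∈ refl with ∈-++⁻ (middleCodes (suc (suc n)) n) c∈
  ... | inj₁ c∈middle with ∈-middleCodes⁻ _ n c∈middle
  ...   | _ , _ , refl , n<n , _ = <-irrefl refl n<n
  head∉ c∈ refl | inj₂ c∈bottom with () ← bottomCodes-bottom _ c∈bottom
codes-unique {suc zero} (s≤s ())

run : ℕ → Word → ℕ
run i []      = 0
run i (a ∷ w) = if idx a ≡ᵇ i then suc (run i w) else 0

decode : Word → Code
decode []      = 0 , 0 , 0
decode (a ∷ w) = pred (idx a) , suc (run (idx a) w) , length w ∸ run (idx a) w

run-⟦⟧ : ∀ t p q → run (suc t) ⟦ t , p , q ⟧ ≡ p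
run-⟦⟧ t (suc p) q rewrite ≡ᵇ-refl t = cong suc (run-⟦⟧ t p q)
run-⟦⟧ t zero    zero    = refl
run-⟦⟧ t zero    (suc q) rewrite ≡ᵇ-suc t = refl

decode-⟦⟧ : ∀ t p q → decode ⟦ t , suc p , q ⟧ ≡ (t , suc p , q)
decode-⟦⟧ t p q
  rewrite run-⟦⟧ t p q | length-++ (replicate p (X (suc t))) {replicate q (X t)}
        | length-replicate p {X (suc t)} | length-replicate q {X t} | m+n∸m≡n p q = refl

decode-support : ∀ {n c} → 1 ≤ n → Support n c → decode ⟦ c ⟧ ≡ c
decode-support _ (middle {t} _ (long {p} {q} _))  = decode-⟦⟧ (suc t) p (suc q)
decode-support _ (middle {t} _ (short {p} {q} _ _)) = decode-⟦⟧ (suc t) p q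
decode-support _ (power {p} _ _)                  = decode-⟦⟧ 0 p 0
decode-support {suc n} _ x₁ⁿx₀                    = decode-⟦⟧ 0 n 1
decode-support {n} _ (xₙxₙ₋₁ⁿ {t} _)              = decode-⟦⟧ t 0 n
decode-support _ (empty _ _)                      = refl

⟦codes⟧-unique : ∀ {n} → 2 ≤ n → Unique (map ⟦_⟧ (codes n))
⟦codes⟧-unique {n} 2≤n = Unique.map⁻ (subst Unique (sym decode-codes) (codes-unique 2≤n))
  where
  decode-codes : map decode (map ⟦_⟧ (codes n)) ≡ codes n
  decode-codes = trans (sym (map-∘ (codes n)))
                       (map-id-local (All.tabulate (decode-support (≤-trans (s≤s z≤n) 2≤n) ∘ ∈-codes⁻ 2≤n)))

InSupport : ℕ → Word → Set
InSupport n w = ∃ λ c → Support n c × w ≡ ⟦ c ⟧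

∈-⟦codes⟧⇔ : ∀ {n w} → 2 ≤ n → w ∈ map ⟦_⟧ (codes n) ⇔ InSupport n w
∈-⟦codes⟧⇔ 2≤n = mk⇔ (λ w∈ → let c , c∈ , w≡ = ∈-map⁻ ⟦_⟧ w∈ in c , ∈-codes⁻ 2≤n c∈ , w≡)
                    (λ { (c , s , refl) → ∈-map⁺ ⟦_⟧ (∈-codes⁺ s) })

words-D-step : ∀ {n e} → 3 ≤ n → (∀ {w} → w ∈ words e ⇔ InSupport n w) →
  ∀ {w} → w ∈ words (D e) ⇔ InSupport (suc n) w
words-D-step {n} {e} h3 words⇔ = mk⇔ to from
  where
  to : ∀ {w} → w ∈ words (D e) → InSupport (suc n) w
  to w∈ with ∈-words-D⁻ w∈
  ... | v , v∈ , w∈Dv with Equivalence.to words⇔ v∈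
  ... | c , s , refl with ∈-map⁻ ⟦_⟧ (subst (_ ∈_) (words-Dword-⟦⟧ c) w∈Dv)
  ... | d , d∈ , refl with forward h3 s (∈-image⁻ d∈)
  ... | supported-by s′ eq = _ , s′ , eq
  from : ∀ {w} → InSupport (suc n) w → w ∈ words (D e)
  from (d , s , refl) with backward h3 s
  ... | preimage {c} {d′} s′ im eq =
    subst (_∈ words (D e)) eq
      (∈-words-D⁺ (Equivalence.from words⇔ (c , s′ , refl))
                  (subst (⟦ d′ ⟧ ∈_) (sym (words-Dword-⟦⟧ c)) (∈-map⁺ ⟦_⟧ (∈-image⁺ im))))

Word-≟ : DecidableEquality Word
Word-≟ u v = map′ (eqWord-sound u v) (λ { refl → Equivalence.from T-≡ (eqWord-refl u) }) (T? (eqWord u v))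

words-D³⇔ : ∀ {w} → w ∈ words (D^ 3 x₀) ⇔ w ∈ map ⟦_⟧ (codes 3)
words-D³⇔ = mk⇔ (All.lookup words⊆) from
  where
  open import Data.List.Membership.DecPropositional Word-≟ using (_∈?_)
  words⊆ : All (_∈ map ⟦_⟧ (codes 3)) (words (D^ 3 x₀))
  words⊆ = toWitness {a? = All.all? (_∈? map ⟦_⟧ (codes 3)) (words (D^ 3 x₀))} _
  codes⊆ : All (λ c → ⟦ c ⟧ ∈ words (D^ 3 x₀)) (codes 3)
  codes⊆ = toWitness {a? = All.all? (λ c → ⟦ c ⟧ ∈? words (D^ 3 x₀)) (codes 3)} _
  from : ∀ {w} → w ∈ map ⟦_⟧ (codes 3) → w ∈ words (D^ 3 x₀)
  from w∈ with ∈-map⁻ ⟦_⟧ w∈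
  ... | c , c∈ , refl = All.lookup codes⊆ c∈

words-D^⇔ : ∀ n → 3 ≤ n → ∀ {w} → w ∈ words (D^ n x₀) ⇔ InSupport n w
words-D^⇔ (suc (suc (suc zero))) h3 = ⇔-trans words-D³⇔ (∈-⟦codes⟧⇔ (<⇒≤ h3))
words-D^⇔ (suc (suc (suc (suc n)))) _  = words-D-step 3≤3+n (words-D^⇔ (suc (suc (suc n))) 3≤3+n)
  where 3≤3+n : 3 ≤ 3 + n
        3≤3+n = s≤s (s≤s (s≤s z≤n))
words-D^⇔ (suc zero)       (s≤s ())
words-D^⇔ (suc (suc zero)) (s≤s (s≤s ()))

Ω-D^ : ∀ n → 3 ≤ n → Ω (D^ n x₀) ≡ length (codes n)
Ω-D^ n h3 = begin
  Ω (D^ n x₀)                ≡⟨ Ω-positiveTerms (D^-positiveTerms n) (⟦codes⟧-unique 2≤n) words⇔codes ⟩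
  length (map ⟦_⟧ (codes n)) ≡⟨ length-map ⟦_⟧ (codes n) ⟩
  length (codes n)           ∎
  where
  2≤n : 2 ≤ n
  2≤n = <⇒≤ h3
  words⇔codes : ∀ {w} → w ∈ words (D^ n x₀) ⇔ w ∈ map ⟦_⟧ (codes n)
  words⇔codes = ⇔-trans (words-D^⇔ n h3) (⇔-sym (∈-⟦codes⟧⇔ 2≤n))

-- Counting

length-diagonal : ∀ L → length (diagonal L) ≡ L
length-diagonal zero    = refl
length-diagonal (suc L) = cong suc (trans (length-map (map₂ suc) (diagonal L)) (length-diagonal L))

length-shortExponents-step : ∀ n → length (shortExponents (suc (suc n))) ≡ suc n + length (shortExponents n)
length-shortExponents-step n =
  trans (length-++ (diagonal (suc n)) {shortExponents n}) (cong (_+ length (shortExponents n)) (length-diagonal (suc n)))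

length-shortExponents-odd : ∀ k → length (shortExponents (suc (k + k))) ≡ k * suc k
length-shortExponents-odd zero    = refl
length-shortExponents-odd (suc k) = begin
  length (shortExponents (suc (suc k + suc k)))         ≡⟨ cong (λ i → length (shortExponents (suc (suc i)))) (+-suc k k) ⟩
  length (shortExponents (suc (suc (suc (k + k)))))     ≡⟨ length-shortExponents-step (suc (k + k)) ⟩
  suc (suc (k + k)) + length (shortExponents (suc (k + k))) ≡⟨ cong (suc (suc (k + k)) +_) (length-shortExponents-odd k) ⟩
  suc (suc (k + k)) + k * suc k                         ≡⟨ arith k ⟩
  suc k * suc (suc k)                                   ∎
  where arith : ∀ k → suc (suc (k + k)) + k * suc k ≡ suc k * suc (suc k)
        arith = solve-∀

length-shortExponents-even : ∀ k → length (shortExponents (k + k)) ≡ k * k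
length-shortExponents-even zero    = refl
length-shortExponents-even (suc k) = begin
  length (shortExponents (suc k + suc k))           ≡⟨ cong (λ i → length (shortExponents (suc i))) (+-suc k k) ⟩
  length (shortExponents (suc (suc (k + k))))       ≡⟨ length-shortExponents-step (k + k) ⟩
  suc (k + k) + length (shortExponents (k + k))     ≡⟨ cong (suc (k + k) +_) (length-shortExponents-even k) ⟩
  suc (k + k) + k * k                               ≡⟨ arith k ⟩
  suc k * suc k                                     ∎
  where arith : ∀ k → suc (k + k) + k * k ≡ suc k * suc k
        arith = solve-∀

length-powers-odd : ∀ k → length (powers (suc (k + k))) ≡ k
length-powers-odd zero    = refl
length-powers-odd (suc k) rewrite +-suc k k = cong suc (length-powers-odd k)

length-powers-even : ∀ k → length (powers (k + k)) ≡ k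
length-powers-even zero    = refl
length-powers-even (suc k) rewrite +-suc k k = cong suc (length-powers-even k)

length-emptyCode-odd : ∀ k → length (emptyCode (suc (k + k))) ≡ 1
length-emptyCode-odd zero    = refl
length-emptyCode-odd (suc k) rewrite +-suc k k = length-emptyCode-odd k

length-emptyCode-even : ∀ k → length (emptyCode (k + k)) ≡ 0
length-emptyCode-even zero    = refl
length-emptyCode-even (suc k) rewrite +-suc k k = length-emptyCode-even k

length-exponents : ∀ n → length (exponents n) ≡ n + length (shortExponents n)
length-exponents n = trans (length-++ (map (map₂ suc) (diagonal n)) {shortExponents n})
  (cong (_+ length (shortExponents n)) (trans (length-map (map₂ suc) (diagonal n)) (length-diagonal n)))

length-middleCodes : ∀ n j → length (middleCodes n j) ≡ j * length (exponents n)
length-middleCodes n zero    = refl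
length-middleCodes n (suc j) = trans (length-++ (map (suc j ,_) (exponents n)) {middleCodes n j})
  (cong₂ _+_ (length-map {A = ℕ × ℕ} {B = Code} (suc j ,_) (exponents n)) (length-middleCodes n j))

length-codes : ∀ n → length (codes n) ≡
  suc ((n ∸ 2) * (n + length (shortExponents n)) + suc (length (powers n) + length (emptyCode n)))
length-codes n = cong suc (trans (length-++ (middleCodes n (n ∸ 2)) {bottomCodes n})
  (cong₂ _+_ (trans (length-middleCodes n (n ∸ 2)) (cong ((n ∸ 2) *_) (length-exponents n)))
             (cong suc (length-++ (powers n) {emptyCode n}))))

length-codes-odd : ∀ k → length (codes (suc (suc k + suc k))) ≡ 2 * suc k * suc k * suc k + 5 * suc k * suc k + 2
length-codes-odd k = begin
  length (codes (suc (suc k + suc k)))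
    ≡⟨ length-codes (suc (suc k + suc k)) ⟩
  suc ((k + suc k) * (suc (suc k + suc k) + length (shortExponents (suc (suc k + suc k))))
       + suc (length (powers (suc (suc k + suc k))) + length (emptyCode (suc (suc k + suc k)))))
    ≡⟨ cong₂ (λ s p → suc ((k + suc k) * (suc (suc k + suc k) + s) + suc p))
             (length-shortExponents-odd (suc k))
             (cong₂ _+_ (length-powers-odd (suc k)) (length-emptyCode-odd (suc k))) ⟩
  suc ((k + suc k) * (suc (suc k + suc k) + suc k * suc (suc k)) + suc (suc k + 1))
    ≡⟨ arith k ⟩
  2 * suc k * suc k * suc k + 5 * suc k * suc k + 2 ∎
  where arith : ∀ k → suc ((k + suc k) * (suc (suc k + suc k) + suc k * suc (suc k)) + suc (suc k + 1))
                      ≡ 2 * suc k * suc k * suc k + 5 * suc k * suc k + 2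
        arith = solve-∀

length-codes-even : ∀ k → length (codes (suc (suc k) + suc (suc k))) ≡
  (suc (suc k) + 2) * ((2 * suc (suc k) * suc (suc k) ∸ 2 * suc (suc k)) + 1)
length-codes-even k = begin
  length (codes (K + K))
    ≡⟨ length-codes (K + K) ⟩
  suc ((k + K) * (K + K + length (shortExponents (K + K))) + suc (length (powers (K + K)) + length (emptyCode (K + K))))
    ≡⟨ cong₂ (λ s p → suc ((k + K) * (K + K + s) + suc p))
             (length-shortExponents-even K)
             (cong₂ _+_ (length-powers-even K) (length-emptyCode-even K)) ⟩
  suc ((k + K) * (K + K + K * K) + suc (K + 0))
    ≡⟨ arith k ⟩
  (K + 2) * (2 * K * suc k + 1)
    ≡⟨ cong (λ i → (K + 2) * (i + 1)) truncated ⟨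
  (K + 2) * ((2 * K * K ∸ 2 * K) + 1) ∎
  where
  K = suc (suc k)
  arith : ∀ k → suc ((k + suc (suc k)) * (suc (suc k) + suc (suc k) + suc (suc k) * suc (suc k)) + suc (suc (suc k) + 0))
                ≡ (suc (suc k) + 2) * (2 * suc (suc k) * suc k + 1)
  arith = solve-∀
  square-split : ∀ k → 2 * suc (suc k) * suc (suc k) ≡ 2 * suc (suc k) + 2 * suc (suc k) * suc k
  square-split = solve-∀
  truncated : 2 * K * K ∸ 2 * K ≡ 2 * K * suc k
  truncated = trans (cong (_∸ 2 * K) (square-split k)) (m+n∸m≡n (2 * K) (2 * K * suc k))

proposition3p9 :
    ((k : ℕ) → 3 ≤ 2 * k + 1 →
      Ω (D^ (2 * k + 1) x₀) ≡ 2 * k * k * k + 5 * k * k + 2)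
    × ((k : ℕ) → 3 ≤ 2 * k →
      Ω (D^ (2 * k) x₀) ≡ (k + 2) * ((2 * k * k ∸ 2 * k) + 1))
proposition3p9 = odd , even
  where
  odd : (k : ℕ) → 3 ≤ 2 * k + 1 → Ω (D^ (2 * k + 1) x₀) ≡ 2 * k * k * k + 5 * k * k + 2
  odd (suc k) h3 = begin
    Ω (D^ (2 * suc k + 1) x₀)           ≡⟨ cong (λ n → Ω (D^ n x₀)) (n≡ k) ⟩
    Ω (D^ (suc (suc k + suc k)) x₀)     ≡⟨ Ω-D^ _ (subst (3 ≤_) (n≡ k) h3) ⟩
    length (codes (suc (suc k + suc k))) ≡⟨ length-codes-odd k ⟩
    2 * suc k * suc k * suc k + 5 * suc k * suc k + 2 ∎
    where n≡ : ∀ k → 2 * suc k + 1 ≡ suc (suc k + suc k)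
          n≡ = solve-∀
  odd zero (s≤s ())
  even : (k : ℕ) → 3 ≤ 2 * k → Ω (D^ (2 * k) x₀) ≡ (k + 2) * ((2 * k * k ∸ 2 * k) + 1)
  even (suc (suc k)) h3 = begin
    Ω (D^ (2 * suc (suc k)) x₀)                ≡⟨ cong (λ n → Ω (D^ n x₀)) (n≡ k) ⟩
    Ω (D^ (suc (suc k) + suc (suc k)) x₀)      ≡⟨ Ω-D^ _ (subst (3 ≤_) (n≡ k) h3) ⟩
    length (codes (suc (suc k) + suc (suc k))) ≡⟨ length-codes-even k ⟩
    (suc (suc k) + 2) * ((2 * suc (suc k) * suc (suc k) ∸ 2 * suc (suc k)) + 1) ∎
    where n≡ : ∀ k → 2 * suc (suc k) ≡ suc (suc k) + suc (suc k)
          n≡ = solve-∀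
  even (suc zero) (s≤s (s≤s ()))
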